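{- Let $k>1$. For $i\in\{1,\ldots,2k-1\}$ let $\Sigma_i^k$ be the set of vertices $v_0v_1\cdots v_{2k-1}$ of $ST^2_k$ such that $v_0=v_i$. Then each $\Sigma_i^k$ is an efficient dominating set (E-set) of $ST^2_k$, and the $2k-1$ sets $\Sigma_1^k,\ldots,\Sigma_{2k-1}^k$ form a partition of $V(ST^2_k)$.
   Context: $ST^2_k$ has as vertices all strings $v_0\cdots v_{2k-1}$ over $\{0,\ldots,k-1\}$ in which each symbol occurs exactly twice; $v,w$ are adjacent iff $w$ arises from $v$ by swapping $v_0$ with some $v_j$ ($1\le j\le 2k-1$) with $v_j\neq v_0$. A set $S\subseteq V(G)$ is an efficient dominating set (E-set) if every vertex of $V(G)\setminus S$ is adjacent to exactly one vertex of $S$. -}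

module Defs where

open import Data.Nat using (ℕ; suc; _*_)
open import Data.Fin using (Fin; zero)
open import Data.Fin.Properties using (_≟_)
open import Data.Vec using (Vec; lookup; count; _[_]≔_)
open import Data.Product using (Σ; _×_; ∃)
open import Relation.Binary.PropositionalEquality using (_≡_; _≢_)
open import Relation.Nullary using (¬_)

Str : ℕ → Set
Str k = Vec (Fin k) (2 * k)

IsVertex : (k : ℕ) → Str k → Set
IsVertex k v = (s : Fin k) → count (_≟ s) v ≡ 2

-- From here on k = suc m (so that position 0 of a string exists as `zero`).
-- swap v₀ with v_j
swap₀ : (m : ℕ) → Str (suc m) → Fin (2 * suc m) → Str (suc m)
swap₀ m v j = (v [ zero ]≔ lookup v j) [ j ]≔ lookup v zero

Adj : (m : ℕ) → Str (suc m) → Str (suc m) → Set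
Adj m v w = Σ (Fin (2 * suc m)) λ j → (j ≢ zero) × (lookup v j ≢ lookup v zero) × (w ≡ swap₀ m v j)

IsESet : (m : ℕ) → (Str (suc m) → Set) → Set
IsESet m S =
  ((v : Str (suc m)) → S v → IsVertex (suc m) v) ×
  ((v : Str (suc m)) → IsVertex (suc m) v → ¬ S v →
     Σ (Str (suc m)) λ u → S u × Adj m u v ×
       ((u' : Str (suc m)) → S u' → Adj m u' v → u' ≡ u))

SigmaSet : (m : ℕ) → Fin (2 * suc m) → Str (suc m) → Set
SigmaSet m i v = IsVertex (suc m) v × (lookup v zero ≡ lookup v i)

{-# OPTIONS --safe #-}
module Submission where

-- In a vertex v every symbol occurs exactly twice, so each position i has a
-- unique twin j ≠ i with v_j = v_i.  The twin of position 0 is the unique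
-- i ≠ 0 with v ∈ Σ_i, which gives the partition.  If v ∉ Σ_i, the only swap
-- v₀ ↔ v_j making positions 0 and i agree is the one with j the twin of i
-- (j ∉ {0, i} since v₀ ≠ v_i); as adjacency is symmetric, swap₀ v j is then
-- the unique neighbour of v in Σ_i.

open import Defs
open import Level using (Level)
open import Data.Bool using (true; false)
open import Data.Nat using (ℕ; suc; _+_; _*_; _<_)
import Data.Nat.Properties as ℕ
open import Data.Fin using (Fin; zero; suc; punchIn; punchOut)
open import Data.Fin.Properties using (_≟_; punchInᵢ≢i; punchOut-punchIn; punchOut-injective)
open import Data.Vec using (Vec; []; _∷_; lookup; count; _[_]≔_; removeAt; allFin; map; _++_)
open import Data.Vec.Properties using (lookup∘update; lookup∘update′; removeAt-punchOut; allFin-map)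
open import Data.Vec.Relation.Binary.Pointwise.Extensional using (ext; Pointwise-≡⇒≡)
open import Data.Product using (Σ; ∃-syntax; _×_; _,_; proj₁)
open import Function using (_∘_)
open import Relation.Nullary using (¬_; yes; no; does; contradiction)
open import Relation.Unary using (Pred; Decidable)
open import Relation.Binary.PropositionalEquality
  using (_≡_; _≢_; refl; sym; trans; cong; cong₂; subst; ≢-sym; module ≡-Reasoning)

private
  variable
    a p : Level
    A : Set a
    n l : ℕ

removeAt-punchIn : ∀ (xs : Vec A (suc n)) i j → lookup (removeAt xs i) j ≡ lookup xs (punchIn i j)
removeAt-punchIn xs i j = begin
  lookup (removeAt xs i) j                      ≡⟨ cong (lookup (removeAt xs i)) (punchOut-punchIn i) ⟨
  lookup (removeAt xs i) (punchOut i≢punchIn)   ≡⟨ removeAt-punchOut xs i≢punchIn ⟩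
  lookup xs (punchIn i j)                       ∎
  where
  open ≡-Reasoning
  i≢punchIn : i ≢ punchIn i j
  i≢punchIn = punchInᵢ≢i i j ∘ sym

module _ {P : Pred A p} (P? : Decidable P) where

  count-∷-comm : ∀ x y (xs : Vec A n) → count P? (x ∷ y ∷ xs) ≡ count P? (y ∷ x ∷ xs)
  count-∷-comm x y xs with does (P? x) | does (P? y)
  ... | true  | true  = refl
  ... | true  | false = refl
  ... | false | true  = refl
  ... | false | false = refl

  count-∷-cong : ∀ x {xs ys : Vec A n} → count P? xs ≡ count P? ys → count P? (x ∷ xs) ≡ count P? (x ∷ ys)
  count-∷-cong x eq with does (P? x)
  ... | true  = cong suc eq
  ... | false = eq

  count-∷-cancel : ∀ x {xs ys : Vec A n} → count P? (x ∷ xs) ≡ count P? (x ∷ ys) → count P? xs ≡ count P? ys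
  count-∷-cancel x eq with does (P? x)
  ... | true  = ℕ.suc-injective eq
  ... | false = eq

  count-++ : ∀ (xs : Vec A n) (ys : Vec A l) → count P? (xs ++ ys) ≡ count P? xs + count P? ys
  count-++ []       ys = refl
  count-++ (x ∷ xs) ys with does (P? x)
  ... | true  = cong suc (count-++ xs ys)
  ... | false = count-++ xs ys

  count-update : ∀ (xs : Vec A n) i y → count P? (lookup xs i ∷ xs [ i ]≔ y) ≡ count P? (y ∷ xs)
  count-update (x ∷ xs) zero    y = count-∷-comm x y xs
  count-update (x ∷ xs) (suc i) y = begin
    count P? (lookup xs i ∷ x ∷ xs [ i ]≔ y)  ≡⟨ count-∷-comm (lookup xs i) x (xs [ i ]≔ y) ⟩
    count P? (x ∷ lookup xs i ∷ xs [ i ]≔ y)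
      ≡⟨ count-∷-cong x {lookup xs i ∷ xs [ i ]≔ y} {y ∷ xs} (count-update xs i y) ⟩
    count P? (x ∷ y ∷ xs)                     ≡⟨ count-∷-comm x y xs ⟩
    count P? (y ∷ x ∷ xs)                     ∎
    where open ≡-Reasoning

  count-removeAt : ∀ (xs : Vec A (suc n)) i → P (lookup xs i) → count P? xs ≡ suc (count P? (removeAt xs i))
  count-removeAt (x ∷ xs) zero px with P? x
  ... | yes _  = refl
  ... | no ¬px = contradiction px ¬px
  count-removeAt (x ∷ xs@(_ ∷ _)) (suc i) pxᵢ with does (P? x)
  ... | true  = cong suc (count-removeAt xs i pxᵢ)
  ... | false = count-removeAt xs i pxᵢ

  count-removeAt-pred : ∀ (xs : Vec A (suc n)) i {c} → P (lookup xs i) →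
                        count P? xs ≡ suc c → count P? (removeAt xs i) ≡ c
  count-removeAt-pred xs i pxᵢ eq = ℕ.suc-injective (trans (sym (count-removeAt xs i pxᵢ)) eq)

  count≡suc⇒∃ : ∀ (xs : Vec A n) {c} → count P? xs ≡ suc c → ∃[ i ] P (lookup xs i)
  count≡suc⇒∃ (x ∷ xs) eq with P? x
  ... | yes px = zero , px
  ... | no _   = let (i , pxᵢ) = count≡suc⇒∃ xs eq in suc i , pxᵢ

  count≡0⇒¬P : ∀ (xs : Vec A n) → count P? xs ≡ 0 → ∀ i → ¬ P (lookup xs i)
  count≡0⇒¬P xs@(_ ∷ _) eq i pxᵢ = ℕ.0≢1+n (trans (sym eq) (count-removeAt xs i pxᵢ))

  count≡1⇒≡ : ∀ (xs : Vec A n) {i j} → count P? xs ≡ 1 → P (lookup xs i) → P (lookup xs j) → i ≡ j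
  count≡1⇒≡ xs@(_ ∷ _) {i} {j} eq pxᵢ pxⱼ with i ≟ j
  ... | yes i≡j = i≡j
  ... | no i≢j  = contradiction (subst P (sym (removeAt-punchOut xs i≢j)) pxⱼ)
                    (count≡0⇒¬P (removeAt xs i) (count-removeAt-pred xs i pxᵢ eq) (punchOut i≢j))

  count≡2⇒∃≢ : ∀ (xs : Vec A (suc n)) {i} → count P? xs ≡ 2 → P (lookup xs i) →
               ∃[ j ] i ≢ j × P (lookup xs j)
  count≡2⇒∃≢ xs {i} eq pxᵢ =
    let (j , pyⱼ) = count≡suc⇒∃ (removeAt xs i) (count-removeAt-pred xs i pxᵢ eq)
    in punchIn i j , punchInᵢ≢i i j ∘ sym , subst P (removeAt-punchIn xs i j) pyⱼ

  count≡2⇒≡ : ∀ (xs : Vec A (suc n)) {i j l} → count P? xs ≡ 2 → P (lookup xs i) →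
              i ≢ j → i ≢ l → P (lookup xs j) → P (lookup xs l) → j ≡ l
  count≡2⇒≡ xs {i} eq pxᵢ i≢j i≢l pxⱼ pxₗ = punchOut-injective i≢j i≢l
    (count≡1⇒≡ (removeAt xs i) (count-removeAt-pred xs i pxᵢ eq)
      (subst P (sym (removeAt-punchOut xs i≢j)) pxⱼ)
      (subst P (sym (removeAt-punchOut xs i≢l)) pxₗ))

count-map-suc-zero : ∀ (xs : Vec (Fin n) l) → count (_≟ zero) (map suc xs) ≡ 0
count-map-suc-zero []       = refl
count-map-suc-zero (x ∷ xs) = count-map-suc-zero xs

count-map-suc : ∀ (xs : Vec (Fin n) l) s → count (_≟ suc s) (map suc xs) ≡ count (_≟ s) xs
count-map-suc []       s = refl
count-map-suc (x ∷ xs) s with does (x ≟ s)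
... | true  = cong suc (count-map-suc xs s)
... | false = count-map-suc xs s

count-allFin : ∀ n (s : Fin n) → count (_≟ s) (allFin n) ≡ 1
count-allFin (suc n) s = trans (cong (count (_≟ s)) (allFin-map n)) (count-zero∷map-suc s)
  where
  count-zero∷map-suc : ∀ s → count (_≟ s) (zero ∷ map suc (allFin n)) ≡ 1
  count-zero∷map-suc zero    = cong suc (count-map-suc-zero (allFin n))
  count-zero∷map-suc (suc s) = trans (count-map-suc (allFin n) s) (count-allFin n s)

-- swap₀ m v j unfolds to swap v zero j.
swap : Vec A n → Fin n → Fin n → Vec A n
swap xs i j = (xs [ i ]≔ lookup xs j) [ j ]≔ lookup xs i

module _ (xs : Vec A n) (i j : Fin n) where

  lookup∘swap₂ : lookup (swap xs i j) j ≡ lookup xs i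
  lookup∘swap₂ = lookup∘update j (xs [ i ]≔ lookup xs j) (lookup xs i)

  lookup∘swap′ : ∀ {l} → l ≢ i → l ≢ j → lookup (swap xs i j) l ≡ lookup xs l
  lookup∘swap′ l≢i l≢j =
    trans (lookup∘update′ l≢j (xs [ i ]≔ lookup xs j) (lookup xs i)) (lookup∘update′ l≢i xs (lookup xs j))

  lookup∘swap₁ : lookup (swap xs i j) i ≡ lookup xs j
  lookup∘swap₁ with i ≟ j
  ... | yes refl = lookup∘update i (xs [ i ]≔ lookup xs i) (lookup xs i)
  ... | no i≢j   =
    trans (lookup∘update′ i≢j (xs [ i ]≔ lookup xs j) (lookup xs i)) (lookup∘update i xs (lookup xs j))

  count-swap : {P : Pred A p} (P? : Decidable P) → count P? (swap xs i j) ≡ count P? xs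
  count-swap P? = count-∷-cancel P? (lookup xs j) {swap xs i j} {xs} (begin
    count P? (lookup xs j ∷ swap xs i j)            ≡⟨ cong (λ x → count P? (x ∷ swap xs i j)) ysⱼ≡xsⱼ ⟨
    count P? (lookup ys j ∷ ys [ j ]≔ lookup xs i)  ≡⟨ count-update P? ys j (lookup xs i) ⟩
    count P? (lookup xs i ∷ ys)                     ≡⟨ count-update P? xs i (lookup xs j) ⟩
    count P? (lookup xs j ∷ xs)                     ∎)
    where
    open ≡-Reasoning
    ys : Vec A n
    ys = xs [ i ]≔ lookup xs j
    ysⱼ≡xsⱼ : lookup ys j ≡ lookup xs j
    ysⱼ≡xsⱼ with i ≟ j
    ... | yes refl = lookup∘update i xs (lookup xs i)
    ... | no i≢j   = lookup∘update′ (≢-sym i≢j) xs (lookup xs j)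

swap-involutive : ∀ (xs : Vec A n) i j → swap (swap xs i j) i j ≡ xs
swap-involutive xs i j = Pointwise-≡⇒≡ (ext pointwise)
  where
  pointwise : ∀ l → lookup (swap (swap xs i j) i j) l ≡ lookup xs l
  pointwise l with l ≟ j | l ≟ i
  ... | yes refl | _        = trans (lookup∘swap₂ (swap xs i l) i l) (lookup∘swap₁ xs i l)
  ... | no _     | yes refl = trans (lookup∘swap₁ (swap xs l j) l j) (lookup∘swap₂ xs l j)
  ... | no l≢j   | no l≢i   =
    trans (lookup∘swap′ (swap xs i j) i j l≢i l≢j) (lookup∘swap′ xs i j l≢i l≢j)

module _ (m : ℕ) where

  swap-isVertex : ∀ v → IsVertex (suc m) v → ∀ i j → IsVertex (suc m) (swap v i j)
  swap-isVertex v vᵥ i j s = trans (count-swap v i j (_≟ s)) (vᵥ s)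

  twin : ∀ v → IsVertex (suc m) v → ∀ i → ∃[ j ] i ≢ j × lookup v j ≡ lookup v i
  twin v vᵥ i = count≡2⇒∃≢ (_≟ lookup v i) v (vᵥ (lookup v i)) refl

  twin-unique : ∀ v {i j l} → IsVertex (suc m) v → i ≢ j → i ≢ l →
                lookup v j ≡ lookup v i → lookup v l ≡ lookup v i → j ≡ l
  twin-unique v {i} vᵥ = count≡2⇒≡ (_≟ lookup v i) v (vᵥ (lookup v i)) refl

  Adj-sym : ∀ {u v} → Adj m u v → Adj m v u
  Adj-sym {u} (j , j≢0 , uⱼ≢u₀ , refl) = j , j≢0 , vⱼ≢v₀ , sym (swap-involutive u zero j)
    where
    vⱼ≢v₀ : lookup (swap₀ m u j) j ≢ lookup (swap₀ m u j) zero
    vⱼ≢v₀ vⱼ≡v₀ =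
      uⱼ≢u₀ (sym (trans (sym (lookup∘swap₂ u zero j)) (trans vⱼ≡v₀ (lookup∘swap₁ u zero j))))

  swap₀∈Σ⇒twin : ∀ v {i j} → lookup v zero ≢ lookup v i → i ≢ zero → SigmaSet m i (swap₀ m v j) →
                 i ≢ j × lookup v j ≡ lookup v i
  swap₀∈Σ⇒twin v {i} {j} v₀≢vᵢ i≢0 (_ , e) with i ≟ j
  ... | yes refl =
    contradiction (trans (sym (lookup∘swap₂ v zero i)) (trans (sym e) (lookup∘swap₁ v zero i))) v₀≢vᵢ
  ... | no i≢j   = i≢j , trans (sym (lookup∘swap₁ v zero j)) (trans e (lookup∘swap′ v zero j i≢0 i≢j))

  twin⇒swap₀∈Σ : ∀ v {i j} → IsVertex (suc m) v → i ≢ zero → i ≢ j → lookup v j ≡ lookup v i →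
                 SigmaSet m i (swap₀ m v j)
  twin⇒swap₀∈Σ v {i} {j} vᵥ i≢0 i≢j vⱼ≡vᵢ = swap-isVertex v vᵥ zero j , (begin
    lookup (swap₀ m v j) zero  ≡⟨ lookup∘swap₁ v zero j ⟩
    lookup v j                 ≡⟨ vⱼ≡vᵢ ⟩
    lookup v i                 ≡⟨ lookup∘swap′ v zero j i≢0 i≢j ⟨
    lookup (swap₀ m v j) i     ∎)
    where open ≡-Reasoning

  Σ-isESet : ∀ {i} → i ≢ zero → IsESet m (SigmaSet m i)
  Σ-isESet {i} i≢0 = (λ _ → proj₁) , dominate
    where
    dominate : ∀ v → IsVertex (suc m) v → ¬ SigmaSet m i v →
               Σ (Str (suc m)) λ u → SigmaSet m i u × Adj m u v ×
                 (∀ u' → SigmaSet m i u' → Adj m u' v → u' ≡ u)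
    dominate v vᵥ v∉Σ with twin v vᵥ i
    ... | b , i≢b , vb≡vᵢ =
      swap₀ m v b , twin⇒swap₀∈Σ v vᵥ i≢0 i≢b vb≡vᵢ , Adj-sym (b , b≢0 , vb≢v₀ , refl) , unique
      where
      v₀≢vᵢ : lookup v zero ≢ lookup v i
      v₀≢vᵢ v₀≡vᵢ = v∉Σ (vᵥ , v₀≡vᵢ)
      vb≢v₀ : lookup v b ≢ lookup v zero
      vb≢v₀ vb≡v₀ = v₀≢vᵢ (trans (sym vb≡v₀) vb≡vᵢ)
      b≢0 : b ≢ zero
      b≢0 refl = vb≢v₀ refl
      unique : ∀ u' → SigmaSet m i u' → Adj m u' v → u' ≡ swap₀ m v b
      unique u' u'∈Σ adj with Adj-sym adj
      ... | b' , _ , _ , refl =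
        let (i≢b' , vb'≡vᵢ) = swap₀∈Σ⇒twin v v₀≢vᵢ i≢0 u'∈Σ
        in cong (swap₀ m v) (twin-unique v vᵥ i≢b' i≢b vb'≡vᵢ vb≡vᵢ)

  allFin-twice : Str (suc m)
  allFin-twice = allFin (suc m) ++ allFin (suc m) ++ []

  allFin-twice-isVertex : IsVertex (suc m) allFin-twice
  allFin-twice-isVertex s = begin
    count (_≟ s) allFin-twice
      ≡⟨ count-++ (_≟ s) (allFin (suc m)) _ ⟩
    count (_≟ s) (allFin (suc m)) + count (_≟ s) (allFin (suc m) ++ [])
      ≡⟨ cong₂ _+_ (count-allFin (suc m) s) (count-++ (_≟ s) (allFin (suc m)) []) ⟩
    1 + (count (_≟ s) (allFin (suc m)) + 0)
      ≡⟨ cong (λ c → 1 + (c + 0)) (count-allFin (suc m) s) ⟩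
    2 ∎
    where open ≡-Reasoning

  Σ-nonempty : ∀ {i} → i ≢ zero → Σ (Str (suc m)) (SigmaSet m i)
  Σ-nonempty {i} i≢0 =
    let (b , i≢b , vb≡vᵢ) = twin allFin-twice allFin-twice-isVertex i
    in swap₀ m allFin-twice b , twin⇒swap₀∈Σ allFin-twice allFin-twice-isVertex i≢0 i≢b vb≡vᵢ

  Σ-partition : ∀ v → IsVertex (suc m) v →
                Σ (Fin (2 * suc m)) λ i → i ≢ zero × SigmaSet m i v ×
                  (∀ i' → i' ≢ zero → SigmaSet m i' v → i' ≡ i)
  Σ-partition v vᵥ =
    let (i , 0≢i , vᵢ≡v₀) = twin v vᵥ zero
    in i , ≢-sym 0≢i , (vᵥ , sym vᵢ≡v₀) ,
       λ i' i'≢0 (_ , v₀≡vᵢ') → twin-unique v vᵥ (≢-sym i'≢0) 0≢i (sym v₀≡vᵢ') vᵢ≡v₀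

theorem18 : (m : ℕ) → 1 < suc m →
  ((i : Fin (2 * suc m)) → i ≢ zero → IsESet m (SigmaSet m i)) ×
  (((i : Fin (2 * suc m)) → i ≢ zero → Σ (Str (suc m)) λ v → SigmaSet m i v) ×
   ((v : Str (suc m)) → IsVertex (suc m) v →
     Σ (Fin (2 * suc m)) λ i → (i ≢ zero) × SigmaSet m i v ×
       ((i' : Fin (2 * suc m)) → i' ≢ zero → SigmaSet m i' v → i' ≡ i)))
theorem18 m _ = (λ _ → Σ-isESet m) , (λ _ → Σ-nonempty m) , Σ-partition m
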